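{- Let $n\ge 4$. Then $E(\mathcal{PSC}_n^{1,1})=\{2(t+1): t\in[0,\lfloor\frac{n-2}{2}\rfloor]\}$ and $E(\mathcal{PSC}_n^{0,1})=\{2t: t\in[2,n-1]\}$.
   Context: For $n\ge 3$, let $C_n$ be the set of $n\times n$ real matrices $A$ whose row $i$ ($1\le i\le n-1$) has a single entry $1$ in column $i+1$ and zeros elsewhere, and whose last row has all entries in $\{0,1\}$. For $A\in C_n$ put $F(A)=A+A^T$. For $\alpha,\mathbf e\in\{0,1\}$ let $C_n^{\alpha,\mathbf e}=\{F(A): A\in C_n,\ a_{n,1}=\alpha,\ a_{n,n}=\mathbf e\}$ and $\mathcal{PSC}_n^{\alpha,\mathbf e}$ the set of primitive matrices in it (a nonnegative matrix is primitive if some power is entrywise positive; its exponent is the least such power). For a set $X$ of matrices, $E(X)$ is the set of exponents of the primitive matrices in $X$. $[a,b]$ denotes the set of integers $k$ with $a\le k\le b$. -}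

module Defs where

open import Data.Nat using (ℕ; zero; suc; _+_; _*_; _∸_; _<_; _≤_; _≟_)
open import Data.Fin using (Fin; toℕ) renaming (zero to fzero; suc to fsuc)
open import Data.Bool using (Bool; true; false; if_then_else_)
open import Data.Product using (Σ; _×_; ∃)
open import Relation.Nullary using (¬_; does)
open import Relation.Binary.PropositionalEquality using (_≡_)

Mat : ℕ → Set
Mat n = Fin n → Fin n → ℕ

sumFin : ∀ {n} → (Fin n → ℕ) → ℕ
sumFin {zero}  f = 0
sumFin {suc n} f = f fzero + sumFin (λ i → f (fsuc i))

_⊗_ : ∀ {n} → Mat n → Mat n → Mat n
(A ⊗ B) i j = sumFin (λ k → A i k * B k j)

identity : ∀ {n} → Mat n
identity i j = if does (toℕ i ≟ toℕ j) then 1 else 0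

_^^_ : ∀ {n} → Mat n → ℕ → Mat n
A ^^ zero  = identity
A ^^ suc k = A ⊗ (A ^^ k)

transpose : ∀ {n} → Mat n → Mat n
transpose A i j = A j i

_⊕_ : ∀ {n} → Mat n → Mat n → Mat n
(A ⊕ B) i j = A i j + B i j

Positive : ∀ {n} → Mat n → Set
Positive A = ∀ i j → 0 < A i j

Primitive : ∀ {n} → Mat n → Set
Primitive A = Σ ℕ λ k → 1 ≤ k × Positive (A ^^ k)

IsExponent : ∀ {n} → Mat n → ℕ → Set
IsExponent A k = 1 ≤ k × Positive (A ^^ k) × (∀ j → 1 ≤ j → j < k → ¬ Positive (A ^^ j))

b2n : Bool → ℕ
b2n true  = 1
b2n false = 0

-- The matrix of C_n with last row r (r j = true means entry 1):
-- rows 1..n-1 (toℕ i + 1 < n) have a single 1 in column i+1.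
companion : (n : ℕ) → (Fin n → Bool) → Mat n
companion n r i j =
  if does (suc (toℕ i) ≟ n)
  then b2n (r j)
  else (if does (toℕ j ≟ suc (toℕ i)) then 1 else 0)

F : ∀ {n} → Mat n → Mat n
F A = A ⊕ transpose A

LastRowCond : (n : ℕ) → Bool → Bool → (Fin n → Bool) → Set
LastRowCond n α e r =
  (∀ j → toℕ j ≡ 0 → r j ≡ α) × (∀ j → suc (toℕ j) ≡ n → r j ≡ e)

-- k ∈ E(PSC_n^{α,e}): some A ∈ C_n with a_{n,1}=α, a_{n,n}=e
-- such that F(A) is primitive with exponent k
InE : (n : ℕ) → Bool → Bool → ℕ → Set
InE n α e k =
  Σ (Fin n → Bool) λ r → LastRowCond n α e r × Primitive (F (companion n r))
    × IsExponent (F (companion n r)) k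

-- Let v be the last vertex of the graph of F(A): a path 0 — 1 — ⋯ — v, a loop at v
-- (e = 1), and edges v — j for the ones of the last row.  If every vertex is reached
-- from v by walks of length D + 1 but some x is not reached by a walk of length D,
-- then the exponent is 2(D + 1): walks i → v → j give positivity, while a walk
-- x → x of odd length, or x → x + 1 of even length, cannot keep to the path (whose
-- edges flip parity), so it passes through v and has length at least 2D + 1.
-- The exponents are then read off from upper bounds on this radius given by explicit
-- walks, and lower bounds from the potential c ∸ ∣ p - t ∣, which drops by at most
-- one along each edge.
module Submission where

open import Defs
open import Data.Nat using (ℕ; zero; suc; _+_; _*_; _∸_; _≤_; _<_; _/_; _%_; z≤n; s≤s; s≤s⁻¹; _≟_; _<?_; _≤?_; ∣_-_∣; parity)
open import Data.Nat.Properties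
open import Data.Nat.DivMod using (m/n*n≤m; m%n<n; m≡m%n+[m/n]*n)
open import Data.Parity.Base using (1ℙ; 0ℙ)
open import Data.Parity.Properties using (+-homo-+) renaming (+-cancelˡ-≡ to ℙ+-cancelˡ-≡)
open import Data.Fin using (Fin; toℕ; fromℕ; fromℕ<) renaming (zero to fzero)
import Data.Fin as Fin
open import Data.Fin.Properties using (toℕ-injective; toℕ<n; toℕ-fromℕ; toℕ-fromℕ<; any?; all?; ¬∀⟶∃¬)
open import Data.Bool using (Bool; true; false; if_then_else_)
open import Data.Product using (Σ; _×_; _,_; proj₁; proj₂; ∃; ∃₂)
open import Data.Sum using (_⊎_; inj₁; inj₂)
open import Function.Bundles using (_⇔_; mk⇔)
open import Relation.Nullary using (¬_; Dec; yes; no; does; contradiction)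
open import Relation.Nullary.Decidable using (_×-dec_; _⊎-dec_; dec-true; dec-false)
open import Relation.Unary using (Decidable)
open import Relation.Binary.Definitions using (tri<; tri≈; tri>)
open import Relation.Binary.PropositionalEquality using (_≡_; _≢_; refl; sym; trans; cong; subst; module ≡-Reasoning)

sumFin-pos⇒∃ : ∀ {n} (f : Fin n → ℕ) → 0 < sumFin f → ∃ λ i → 0 < f i
sumFin-pos⇒∃ {suc n} f p with f fzero in eq
... | suc _ = fzero , subst (0 <_) (sym eq) (s≤s z≤n)
... | zero  = let i , q = sumFin-pos⇒∃ (λ i → f (Fin.suc i)) p in Fin.suc i , q

∃⇒sumFin-pos : ∀ {n} (f : Fin n → ℕ) i → 0 < f i → 0 < sumFin f
∃⇒sumFin-pos f fzero      p = ≤-trans p (m≤m+n (f fzero) _)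
∃⇒sumFin-pos f (Fin.suc i) p = ≤-trans (∃⇒sumFin-pos (λ j → f (Fin.suc j)) i p) (m≤n+m _ (f fzero))

*-pos⇒pos : ∀ a b → 0 < a * b → 0 < a × 0 < b
*-pos⇒pos (suc a) (suc b) _ = s≤s z≤n , s≤s z≤n
*-pos⇒pos (suc a) zero    p = contradiction (subst (0 <_) (*-zeroʳ a) p) (<-irrefl refl)

pos-*-pos : ∀ {a b} → 0 < a → 0 < b → 0 < a * b
pos-*-pos {suc a} {suc b} _ _ = s≤s z≤n

+-pos⇒pos : ∀ a b → 0 < a + b → 0 < a ⊎ 0 < b
+-pos⇒pos (suc a) b _ = inj₁ (s≤s z≤n)
+-pos⇒pos zero    b p = inj₂ p

if-dec-pos : ∀ {P : Set} (d : Dec P) {x y : ℕ} → 0 < (if does d then x else y) → (P × 0 < x) ⊎ 0 < y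
if-dec-pos (yes p) q = inj₁ (p , q)
if-dec-pos (no _)  q = inj₂ q

does-true⇒ : ∀ {P : Set} (d : Dec P) → does d ≡ true → P
does-true⇒ (yes p) _ = p

b2n-pos : ∀ {b} → 0 < b2n b → b ≡ true
b2n-pos {true} _ = refl

identity-pos⇒≡ : ∀ {n} {i j : Fin n} → 0 < identity i j → i ≡ j
identity-pos⇒≡ {i = i} {j} p with if-dec-pos (toℕ i ≟ toℕ j) p
... | inj₁ (e , _) = toℕ-injective e

identity-refl-pos : ∀ {n} (i : Fin n) → 0 < identity i i
identity-refl-pos i = subst (λ b → 0 < (if b then 1 else 0)) (sym (dec-true (toℕ i ≟ toℕ i) refl)) (s≤s z≤n)

isExponent-unique : ∀ {n} {A : Mat n} {k k′} → IsExponent A k → IsExponent A k′ → k ≡ k′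
isExponent-unique {k = k} {k′} (1≤k , pos , below) (1≤k′ , pos′ , below′) with <-cmp k k′
... | tri< k<k′ _ _ = contradiction pos (below′ k 1≤k k<k′)
... | tri≈ _ k≡k′ _ = k≡k′
... | tri> _ _ k′<k = contradiction pos′ (below k′ 1≤k′ k′<k)

isExponent⇒primitive : ∀ {n} {A : Mat n} {k} → IsExponent A k → Primitive A
isExponent⇒primitive {k = k} (1≤k , pos , _) = k , 1≤k , pos

first-crossing : ∀ {P : ℕ → Set} → Decidable P → ∀ ℓ → P ℓ → ¬ P 0 →
                 ∃ λ d → suc d ≤ ℓ × ¬ P d × P (suc d)
first-crossing P? zero    p ¬p₀ = contradiction p ¬p₀
first-crossing P? (suc ℓ) p ¬p₀ with P? ℓ
... | no ¬pℓ = ℓ , ≤-refl , ¬pℓ , p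
... | yes pℓ = let d , d<ℓ , ¬pd , pd+1 = first-crossing P? ℓ pℓ ¬p₀
               in d , m≤n⇒m≤1+n d<ℓ , ¬pd , pd+1

parity-cancelˡ : ∀ a b c → parity (a + b) ≡ parity (a + c) → parity b ≡ parity c
parity-cancelˡ a b c eq =
  ℙ+-cancelˡ-≡ (parity a) (parity b) (parity c) (trans (sym (+-homo-+ a b)) (trans eq (+-homo-+ a c)))

parity[m+n]≡parity[m]⇒even : ∀ m n → parity (m + n) ≡ parity m → parity n ≡ 0ℙ
parity[m+n]≡parity[m]⇒even m n eq = parity-cancelˡ m n 0 (trans eq (cong parity (sym (+-identityʳ m))))

parity[m+n]≡parity[1+m]⇒odd : ∀ m n → parity (m + n) ≡ parity (suc m) → parity n ≡ 1ℙ
parity[m+n]≡parity[1+m]⇒odd m n eq = parity-cancelˡ m n 1 (trans eq (cong parity (+-comm 1 m)))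

parity[1+n+n]≡1ℙ : ∀ n → parity (suc n + n) ≡ 1ℙ
parity[1+n+n]≡1ℙ zero    = refl
parity[1+n+n]≡1ℙ (suc n) = trans (cong (λ k → parity (suc (suc k))) (+-suc n n)) (parity[1+n+n]≡1ℙ n)

2*n≡n+n : ∀ n → 2 * n ≡ n + n
2*n≡n+n n = cong (n +_) (+-identityʳ n)

o≤1+n⇒m∸n≤1+[m∸o] : ∀ m n o → o ≤ suc n → m ∸ n ≤ suc (m ∸ o)
o≤1+n⇒m∸n≤1+[m∸o] zero    n       o             _  = subst (_≤ suc (0 ∸ o)) (sym (0∸n≡0 n)) z≤n
o≤1+n⇒m∸n≤1+[m∸o] (suc m) zero    zero          _  = n≤1+n _
o≤1+n⇒m∸n≤1+[m∸o] (suc m) zero    (suc zero)    _  = ≤-refl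
o≤1+n⇒m∸n≤1+[m∸o] (suc m) zero    (suc (suc o)) (s≤s ())
o≤1+n⇒m∸n≤1+[m∸o] (suc m) (suc n) zero          _  = ≤-trans (m∸n≤m m n) (≤-trans (n≤1+n m) (n≤1+n (suc m)))
o≤1+n⇒m∸n≤1+[m∸o] (suc m) (suc n) (suc o) (s≤s o≤1+n) = o≤1+n⇒m∸n≤1+[m∸o] m n o o≤1+n

∣1+m-n∣≤1+∣m-n∣ : ∀ m n → ∣ suc m - n ∣ ≤ suc ∣ m - n ∣
∣1+m-n∣≤1+∣m-n∣ zero    zero    = ≤-refl
∣1+m-n∣≤1+∣m-n∣ (suc m) zero    = ≤-refl
∣1+m-n∣≤1+∣m-n∣ zero    (suc n) = ≤-trans (n≤1+n n) (n≤1+n (suc n))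
∣1+m-n∣≤1+∣m-n∣ (suc m) (suc n) = ∣1+m-n∣≤1+∣m-n∣ m n

∣m-n∣≤1+∣1+m-n∣ : ∀ m n → ∣ m - n ∣ ≤ suc ∣ suc m - n ∣
∣m-n∣≤1+∣1+m-n∣ zero    zero          = z≤n
∣m-n∣≤1+∣1+m-n∣ (suc m) zero          = ≤-trans (n≤1+n (suc m)) (n≤1+n _)
∣m-n∣≤1+∣1+m-n∣ zero    (suc zero)    = ≤-refl
∣m-n∣≤1+∣1+m-n∣ zero    (suc (suc n)) = ≤-refl
∣m-n∣≤1+∣1+m-n∣ (suc m) (suc n)       = ∣m-n∣≤1+∣1+m-n∣ m n

m≤2[1+[m∸1]/2] : ∀ m → m ≤ suc ((m ∸ 1) / 2) + suc ((m ∸ 1) / 2)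
m≤2[1+[m∸1]/2] m = begin
  m                              ≤⟨ m≤n+m∸n m 1 ⟩
  suc (m ∸ 1)                    ≡⟨ cong suc (m≡m%n+[m/n]*n (m ∸ 1) 2) ⟩
  suc ((m ∸ 1) % 2 + h * 2)      ≤⟨ s≤s (+-monoˡ-≤ (h * 2) (s≤s⁻¹ (m%n<n (m ∸ 1) 2))) ⟩
  suc (suc (h * 2))              ≡⟨ cong (λ k → suc (suc k)) (trans (*-comm h 2) (2*n≡n+n h)) ⟩
  suc (suc (h + h))              ≡⟨ cong suc (sym (+-suc h h)) ⟩
  suc h + suc h                  ∎
  where
  open ≤-Reasoning
  h : ℕ
  h = (m ∸ 1) / 2

t≤[m∸1]/2⇒2t<m : ∀ {m t} → 1 ≤ m → t ≤ (m ∸ 1) / 2 → t + t < m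
t≤[m∸1]/2⇒2t<m {suc m} {t} _ t≤h = s≤s (begin
  t + t          ≡⟨ sym (trans (*-comm t 2) (2*n≡n+n t)) ⟩
  t * 2          ≤⟨ *-monoˡ-≤ 2 t≤h ⟩
  (m / 2) * 2    ≤⟨ m/n*n≤m m 2 ⟩
  m              ∎)
  where open ≤-Reasoning

module Walks {n : ℕ} (A : Mat n) where

  Edge : Fin n → Fin n → Set
  Edge i j = 0 < A i j

  Walk : ℕ → Fin n → Fin n → Set
  Walk zero    i j = i ≡ j
  Walk (suc k) i j = ∃ λ h → Edge i h × Walk k h j

  ^-pos⇒Walk : ∀ k {i j} → 0 < (A ^^ k) i j → Walk k i j
  ^-pos⇒Walk zero            p = identity-pos⇒≡ p
  ^-pos⇒Walk (suc k) {i} {j} p =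
    let h , q = sumFin-pos⇒∃ _ p
        e , p′ = *-pos⇒pos (A i h) _ q
    in h , e , ^-pos⇒Walk k p′

  Walk⇒^-pos : ∀ k {i j} → Walk k i j → 0 < (A ^^ k) i j
  Walk⇒^-pos zero    {i} refl    = identity-refl-pos i
  Walk⇒^-pos (suc k) (h , e , w) = ∃⇒sumFin-pos _ h (pos-*-pos e (Walk⇒^-pos k w))

  walk? : ∀ k i j → Dec (Walk k i j)
  walk? zero    i j = i Fin.≟ j
  walk? (suc k) i j = any? λ h → (0 <? A i h) ×-dec walk? k h j

  _++ʷ_ : ∀ {a b i h j} → Walk a i h → Walk b h j → Walk (a + b) i j
  _++ʷ_ {zero}  refl          w′ = w′
  _++ʷ_ {suc a} (h , e , w)   w′ = h , e , w ++ʷ w′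

  _∷ʳʷ_ : ∀ {k i h j} → Walk k i h → Edge h j → Walk (suc k) i j
  _∷ʳʷ_ {zero}  refl        e′ = _ , e′ , refl
  _∷ʳʷ_ {suc k} (h , e , w) e′ = h , e , w ∷ʳʷ e′

  reverse : (∀ i j → Edge i j → Edge j i) → ∀ {k i j} → Walk k i j → Walk k j i
  reverse sym {zero}  refl            = refl
  reverse sym {suc k} {i} (h , e , w) = reverse sym w ∷ʳʷ sym i h e

  potential-bound : (ψ : Fin n → ℕ) → (∀ i j → Edge i j → ψ i ≤ suc (ψ j)) →
                    ∀ {k i j} → Walk k i j → ψ i ≤ k + ψ j
  potential-bound ψ step {zero}  refl            = ≤-refl
  potential-bound ψ step {suc k} {i} (h , e , w) = ≤-trans (step i h e) (s≤s (potential-bound ψ step w))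

module CompanionGraph (m : ℕ) (r : Fin (suc m) → Bool) where

  M : Mat (suc m)
  M = F (companion (suc m) r)

  open Walks M public

  last : Fin (suc m)
  last = fromℕ m

  toℕ≡m⇒last : ∀ {i} → toℕ i ≡ m → i ≡ last
  toℕ≡m⇒last e = toℕ-injective (trans e (sym (toℕ-fromℕ m)))

  successor-entry : Fin (suc m) → Fin (suc m) → ℕ
  successor-entry i j = if does (toℕ j ≟ suc (toℕ i)) then 1 else 0

  companion-pos : ∀ {i j} → 0 < companion (suc m) r i j → (i ≡ last × r j ≡ true) ⊎ toℕ j ≡ suc (toℕ i)
  companion-pos {i} {j} p with if-dec-pos (suc (toℕ i) ≟ suc m) p
  ... | inj₁ (i-last , q) = inj₁ (toℕ≡m⇒last (suc-injective i-last) , b2n-pos q)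
  ... | inj₂ q with if-dec-pos (toℕ j ≟ suc (toℕ i)) q
  ...   | inj₁ (j≡1+i , _) = inj₂ j≡1+i

  data Adjacent (i j : Fin (suc m)) : Set where
    step-up     : toℕ j ≡ suc (toℕ i) → Adjacent i j
    step-down   : toℕ i ≡ suc (toℕ j) → Adjacent i j
    out-of-last : i ≡ last → r j ≡ true → Adjacent i j
    into-last   : j ≡ last → r i ≡ true → Adjacent i j

  Edge⇒Adjacent : ∀ {i j} → Edge i j → Adjacent i j
  Edge⇒Adjacent {i} {j} p with +-pos⇒pos (companion (suc m) r i j) _ p
  ... | inj₁ q with companion-pos q
  ...   | inj₁ (i-last , rj) = out-of-last i-last rj
  ...   | inj₂ up            = step-up up
  Edge⇒Adjacent {i} {j} p | inj₂ q with companion-pos q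
  ...   | inj₁ (j-last , ri) = into-last j-last ri
  ...   | inj₂ down          = step-down down

  edge-sym : ∀ i j → Edge i j → Edge j i
  edge-sym i j = subst (0 <_) (+-comm (companion (suc m) r i j) (companion (suc m) r j i))

  edge-up : ∀ i j → toℕ j ≡ suc (toℕ i) → Edge i j
  edge-up i j up = subst (λ c → 0 < c + companion (suc m) r j i) (sym companion≡1) (s≤s z≤n)
    where
    open ≡-Reasoning
    i≢m : suc (toℕ i) ≢ suc m
    i≢m e = <-irrefl (trans up e) (toℕ<n j)
    companion≡1 : companion (suc m) r i j ≡ 1
    companion≡1 = begin
      companion (suc m) r i j
        ≡⟨ cong (if_then b2n (r j) else successor-entry i j) (dec-false (suc (toℕ i) ≟ suc m) i≢m) ⟩
      successor-entry i j
        ≡⟨ cong (if_then 1 else 0) (dec-true (toℕ j ≟ suc (toℕ i)) up) ⟩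
      1 ∎

  edge-last : ∀ {j} → r j ≡ true → Edge last j
  edge-last {j} rj = subst (λ c → 0 < c + companion (suc m) r j last) (sym companion≡1) (s≤s z≤n)
    where
    companion≡1 : companion (suc m) r last j ≡ 1
    companion≡1 = trans (cong (if_then b2n (r j) else successor-entry last j)
                              (dec-true (suc (toℕ last) ≟ suc m) (cong suc (toℕ-fromℕ m))))
                        (cong b2n rj)

  reverse′ : ∀ {k i j} → Walk k i j → Walk k j i
  reverse′ = reverse edge-sym

  walk-down : ∀ d {i j} → toℕ j ≡ toℕ i + d → Walk d j i
  walk-down zero    {i} {j} e = toℕ-injective (trans e (+-identityʳ (toℕ i)))
  walk-down (suc d) {i} {j} e = h , edge-sym h j (edge-up h j j≡1+h) , walk-down d toℕh
    where
    j≡1+i+d : toℕ j ≡ suc (toℕ i + d)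
    j≡1+i+d = trans e (+-suc (toℕ i) d)
    h<1+m : toℕ i + d < suc m
    h<1+m = <⇒≤ (subst (_< suc m) j≡1+i+d (toℕ<n j))
    h : Fin (suc m)
    h = fromℕ< h<1+m
    toℕh : toℕ h ≡ toℕ i + d
    toℕh = toℕ-fromℕ< h<1+m
    j≡1+h : toℕ j ≡ suc (toℕ h)
    j≡1+h = trans j≡1+i+d (cong suc (sym toℕh))

  walk-along : ∀ i j → Walk ∣ toℕ i - toℕ j ∣ i j
  walk-along i j with ≤-total (toℕ i) (toℕ j)
  ... | inj₁ i≤j = subst (λ k → Walk k i j) (sym (m≤n⇒∣m-n∣≡n∸m i≤j))
                     (reverse′ (walk-down (toℕ j ∸ toℕ i) (sym (m+[n∸m]≡n i≤j))))
  ... | inj₂ j≤i = subst (λ k → Walk k i j) (sym (m≤n⇒∣n-m∣≡n∸m j≤i))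
                     (walk-down (toℕ i ∸ toℕ j) (sym (m+[n∸m]≡n j≤i)))

  walk-from-last : ∀ i → Walk (m ∸ toℕ i) last i
  walk-from-last i = subst (λ k → Walk k last i) dist (walk-along last i)
    where
    dist : ∣ toℕ last - toℕ i ∣ ≡ m ∸ toℕ i
    dist = trans (cong (∣_- toℕ i ∣) (toℕ-fromℕ m)) (m≤n⇒∣n-m∣≡n∸m (s≤s⁻¹ (toℕ<n i)))

  walk-via : ∀ h → r h ≡ true → ∀ i → Walk (suc ∣ toℕ h - toℕ i ∣) last i
  walk-via h rh i = h , edge-last rh , walk-along h i

  -- Off the vertex `last`, every edge joins consecutive vertices and flips parity.
  ThroughLast : ℕ → Fin (suc m) → Fin (suc m) → Set
  ThroughLast k x y = ∃₂ λ a b → a + b ≡ k × Walk a x last × Walk b last y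

  through-last-or-parity : ∀ {k x y} → Walk k x y → ThroughLast k x y ⊎ parity (toℕ x + k) ≡ parity (toℕ y)
  through-last-or-parity {zero}  {x} refl = inj₂ (cong parity (+-identityʳ (toℕ x)))
  through-last-or-parity {suc k} {x} (h , e , w) with through-last-or-parity w
  ... | inj₁ (a , b , a+b≡k , w₁ , w₂) = inj₁ (suc a , b , cong suc a+b≡k , (h , e , w₁) , w₂)
  ... | inj₂ par with Edge⇒Adjacent e
  ...   | step-up h≡1+x    = inj₂ (trans (cong parity (trans (+-suc (toℕ x) k) (cong (_+ k) (sym h≡1+x)))) par)
  ...   | step-down x≡1+h  = inj₂ (trans (cong parity (trans (cong (_+ suc k) x≡1+h) (cong suc (+-suc (toℕ h) k)))) par)
  ...   | out-of-last refl _ = inj₁ (0 , suc k , refl , refl , (h , e , w))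
  ...   | into-last refl _   = inj₁ (1 , k , refl , (h , e , refl) , w)

  tent-bound : ∀ c t → c ≤ ∣ m - t ∣ → (∀ i → r i ≡ true → c ≤ suc ∣ toℕ i - t ∣) →
               ∀ {k x} → Walk k last x → c ∸ ∣ toℕ x - t ∣ ≤ k
  tent-bound c t far-last near-row {k} {x} w =
    subst (ψ x ≤_) (trans (cong (k +_) ψ-last) (+-identityʳ k)) (potential-bound ψ step (reverse′ w))
    where
    ψ : Fin (suc m) → ℕ
    ψ i = c ∸ ∣ toℕ i - t ∣
    ψ-last : ψ last ≡ 0
    ψ-last = trans (cong (λ p → c ∸ ∣ p - t ∣) (toℕ-fromℕ m)) (m≤n⇒m∸n≡0 far-last)
    ψ-row : ∀ {i} → r i ≡ true → ψ i ≤ 1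
    ψ-row {i} ri = m≤n+o⇒m∸n≤o c _ (subst (c ≤_) (+-comm 1 _) (near-row i ri))
    step : ∀ i j → Edge i j → ψ i ≤ suc (ψ j)
    step i j e with Edge⇒Adjacent e
    ... | step-up j≡1+i = subst (λ p → ψ i ≤ suc (c ∸ ∣ p - t ∣)) (sym j≡1+i)
                            (o≤1+n⇒m∸n≤1+[m∸o] c _ _ (∣1+m-n∣≤1+∣m-n∣ (toℕ i) t))
    ... | step-down i≡1+j = subst (λ p → c ∸ ∣ p - t ∣ ≤ suc (ψ j)) (sym i≡1+j)
                              (o≤1+n⇒m∸n≤1+[m∸o] c _ _ (∣m-n∣≤1+∣1+m-n∣ (toℕ j) t))
    ... | out-of-last refl _ = subst (_≤ suc (ψ j)) (sym ψ-last) z≤n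
    ... | into-last _ ri     = ≤-trans (ψ-row ri) (s≤s z≤n)

  Radius : ℕ → Set
  Radius ℓ = ∀ i → Walk ℓ last i

  radius? : ∀ ℓ → Dec (Radius ℓ)
  radius? ℓ = all? λ i → walk? ℓ last i

  ¬radius0 : 1 ≤ m → ¬ Radius 0
  ¬radius0 1≤m radius = <-irrefl (trans (sym (cong toℕ (radius fzero))) (toℕ-fromℕ m)) 1≤m

  module _ (loop : r last ≡ true) where

    pad : ∀ {a b x} → Walk a last x → a ≤ b → Walk b last x
    pad {a} {b} w a≤b = subst (λ k → Walk k last _) (m∸n+n≡m a≤b) (loops (b ∸ a) ++ʷ w)
      where
      loops : ∀ d → Walk d last last
      loops zero    = refl
      loops (suc d) = last , edge-last loop , loops d

    ¬Walk⇒< : ∀ {D a x} → ¬ Walk D last x → Walk a last x → D < a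
    ¬Walk⇒< {D} {a} ¬w w with D <? a
    ... | yes D<a = D<a
    ... | no  D≮a = contradiction (pad w (≮⇒≥ D≮a)) ¬w

    isExponent-2[1+D] : ∀ D → Radius (suc D) → ∀ x → ¬ Walk D last x → IsExponent M (2 * suc D)
    isExponent-2[1+D] D radius x far = s≤s z≤n , positive , not-positive
      where
      positive : Positive (M ^^ (2 * suc D))
      positive i j =
        Walk⇒^-pos _ (subst (λ k → Walk k i j) (sym (2*n≡n+n (suc D))) (reverse′ (radius i) ++ʷ radius j))

      x<m : toℕ x < m
      x<m = ≤∧≢⇒< (s≤s⁻¹ (toℕ<n x)) λ x≡m → far (pad (sym (toℕ≡m⇒last x≡m)) z≤n)
      y : Fin (suc m)
      y = fromℕ< (s≤s x<m)
      y≡1+x : toℕ y ≡ suc (toℕ x)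
      y≡1+x = toℕ-fromℕ< (s≤s x<m)

      odd-closed-walk : ∀ {j} → Walk j x x → parity j ≡ 1ℙ → suc D + suc D ≤ j
      odd-closed-walk w odd with through-last-or-parity w
      ... | inj₁ (a , b , refl , w₁ , w₂) = +-mono-≤ (¬Walk⇒< far (reverse′ w₁)) (¬Walk⇒< far w₂)
      ... | inj₂ par = contradiction (trans (sym odd) (parity[m+n]≡parity[m]⇒even (toℕ x) _ par)) λ ()

      even-walk-to-next : ∀ {j} → Walk j x y → parity j ≡ 0ℙ → suc D + D ≤ j
      even-walk-to-next w even with through-last-or-parity w
      ... | inj₁ (a , b , refl , w₁ , w₂) =
        +-mono-≤ (¬Walk⇒< far (reverse′ w₁)) (s≤s⁻¹ (¬Walk⇒< far (w₂ ∷ʳʷ edge-sym x y (edge-up x y y≡1+x))))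
      ... | inj₂ par =
        contradiction (trans (sym even) (parity[m+n]≡parity[1+m]⇒odd (toℕ x) _ (trans par (cong parity y≡1+x)))) λ ()

      not-positive : ∀ j → 1 ≤ j → j < 2 * suc D → ¬ Positive (M ^^ j)
      not-positive j _ j<2[1+D] pos with parity j in eq
      ... | 1ℙ =
        <⇒≱ j<2[1+D] (subst (_≤ j) (sym (2*n≡n+n (suc D))) (odd-closed-walk (^-pos⇒Walk j (pos x x)) eq))
      ... | 0ℙ = contradiction (trans (sym eq) (trans (cong parity j≡1+2D) (parity[1+n+n]≡1ℙ D))) λ ()
        where
        j≤1+2D : j ≤ suc D + D
        j≤1+2D = subst (j ≤_) (+-suc D D) (s≤s⁻¹ (subst (j <_) (2*n≡n+n (suc D)) j<2[1+D]))
        j≡1+2D : j ≡ suc D + D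
        j≡1+2D = ≤-antisym j≤1+2D (even-walk-to-next (^-pos⇒Walk j (pos x y)) eq)

    exponent-of-radius : ∀ {ℓ} → Radius ℓ → ¬ Radius 0 →
                         ∃ λ D → suc D ≤ ℓ × Radius (suc D) × IsExponent M (2 * suc D)
    exponent-of-radius {ℓ} radius ¬radius₀ =
      let D , D<ℓ , ¬radiusD , radiusD+1 = first-crossing radius? ℓ radius ¬radius₀
          x , far = ¬∀⟶∃¬ (suc m) (λ i → Walk D last i) (walk? D last) ¬radiusD
      in D , D<ℓ , radiusD+1 , isExponent-2[1+D] D radiusD+1 x far

last-row : ∀ {m} {r : Fin (suc m) → Bool} {α e} → LastRowCond (suc m) α e r →
           r fzero ≡ α × r (fromℕ m) ≡ e
last-row {m} (r₀ , rₘ) = r₀ fzero refl , rₘ (fromℕ m) (cong suc (toℕ-fromℕ m))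

last-row⁻¹ : ∀ {m} {r : Fin (suc m) → Bool} {α e} → r fzero ≡ α → r (fromℕ m) ≡ e →
             LastRowCond (suc m) α e r
last-row⁻¹ {m} {r} r₀ rₘ =
  (λ j j≡0 → subst (λ i → r i ≡ _) (toℕ-injective (sym j≡0)) r₀) ,
  (λ j 1+j≡1+m → subst (λ i → r i ≡ _) (toℕ-injective (trans (toℕ-fromℕ m) (sym (suc-injective 1+j≡1+m))))
                   rₘ)

exponent-sound-α1 : ∀ {m k} → 1 ≤ m → InE (suc m) true true k →
                    ∃ λ t → t ≤ (m ∸ 1) / 2 × k ≡ 2 * (t + 1)
exponent-sound-α1 {m} 1≤m (r , row , _ , k-exp) =
  let D , D<ℓ , _ , D-exp = exponent-of-radius loop radius (¬radius0 1≤m)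
  in D , s≤s⁻¹ D<ℓ , trans (isExponent-unique k-exp D-exp) (cong (2 *_) (+-comm 1 D))
  where
  open CompanionGraph m r
  r₀ : r fzero ≡ true
  r₀ = proj₁ (last-row row)
  loop : r last ≡ true
  loop = proj₂ (last-row row)
  ℓ : ℕ
  ℓ = suc ((m ∸ 1) / 2)
  radius : Radius ℓ
  radius i with suc (toℕ i) ≤? ℓ
  ... | yes near = pad loop (walk-via fzero r₀ i) near
  ... | no  far  = pad loop (walk-from-last i)
                     (m≤n+o⇒m∸n≤o m (toℕ i) (≤-trans (m≤2[1+[m∸1]/2] m) (+-monoˡ-≤ ℓ (s≤s⁻¹ (≰⇒> far)))))

exponent-sound-α0 : ∀ {m k} → 2 ≤ m → InE (suc m) false true k →
                    ∃ λ t → 2 ≤ t × t ≤ m × k ≡ 2 * t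
exponent-sound-α0 {m} 2≤m (r , row , _ , k-exp) =
  let D , D<m , radiusD+1 , D-exp = exponent-of-radius loop radius (¬radius0 (≤-trans (n≤1+n 1) 2≤m))
  in suc D , 2≤1+D D radiusD+1 , D<m , isExponent-unique k-exp D-exp
  where
  open CompanionGraph m r
  r₀ : r fzero ≡ false
  r₀ = proj₁ (last-row row)
  loop : r last ≡ true
  loop = proj₂ (last-row row)
  radius : Radius m
  radius i = pad loop (walk-from-last i) (m∸n≤m m (toℕ i))
  ¬edge-last-0 : ¬ Edge last fzero
  ¬edge-last-0 e with Edge⇒Adjacent e
  ... | step-down m≡1        = <-irrefl (trans (sym m≡1) (toℕ-fromℕ m)) 2≤m
  ... | out-of-last _ r₀≡1   = contradiction (trans (sym r₀) r₀≡1) λ ()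
  ... | into-last 0≡last _   = <-irrefl (trans (cong toℕ 0≡last) (toℕ-fromℕ m)) (≤-trans (n≤1+n 1) 2≤m)
  2≤1+D : ∀ D → Radius (suc D) → 2 ≤ suc D
  2≤1+D (suc D) _ = s≤s (s≤s z≤n)
  2≤1+D zero radius with radius fzero
  ... | _ , e , refl = contradiction e ¬edge-last-0

-- Last row 1 0 ⋯ 0 1 ⋯ 1 with the second block of ones from 2t: the centre t is then
-- at distance t + 1 from the last vertex, and every vertex within t + 1.
module GapRow {m t : ℕ} (2t<m : t + t < m) where

  Row : Fin (suc m) → Set
  Row j = toℕ j ≡ 0 ⊎ t + t ≤ toℕ j

  row? : Decidable Row
  row? j = toℕ j ≟ 0 ⊎-dec t + t ≤? toℕ j

  r : Fin (suc m) → Bool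
  r j = does (row? j)

  row⇒r : ∀ {j} → Row j → r j ≡ true
  row⇒r {j} = dec-true (row? j)

  open CompanionGraph m r public

  loop : r last ≡ true
  loop = row⇒r (inj₂ (subst (t + t ≤_) (sym (toℕ-fromℕ m)) (<⇒≤ 2t<m)))

  radius : Radius (suc t)
  radius i with toℕ i ≤? t | t + t ≤? toℕ i
  ... | yes i≤t | _        = pad loop (walk-via fzero (row⇒r (inj₁ refl)) i) (s≤s i≤t)
  ... | no  _   | yes 2t≤i = pad loop (i , edge-last (row⇒r (inj₂ 2t≤i)) , refl) (s≤s z≤n)
  ... | no  i≰t | no  2t≰i = pad loop (walk-via q (row⇒r (inj₂ (≤-reflexive (sym q≡2t)))) i) (s≤s dist)
    where
    q : Fin (suc m)
    q = fromℕ< (s≤s (<⇒≤ 2t<m))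
    q≡2t : toℕ q ≡ t + t
    q≡2t = toℕ-fromℕ< (s≤s (<⇒≤ 2t<m))
    dist : ∣ toℕ q - toℕ i ∣ ≤ t
    dist = subst (λ p → ∣ p - toℕ i ∣ ≤ t) (sym q≡2t)
             (subst (_≤ t) (sym (m≤n⇒∣n-m∣≡n∸m (<⇒≤ (≰⇒> 2t≰i))))
               (m≤n+o⇒m∸n≤o (t + t) (toℕ i) (+-monoˡ-≤ t (<⇒≤ (≰⇒> i≰t)))))

  t<1+m : t < suc m
  t<1+m = s≤s (≤-trans (m≤m+n t t) (<⇒≤ 2t<m))

  centre : Fin (suc m)
  centre = fromℕ< t<1+m

  far : ¬ Walk t last centre
  far w = 1+n≰n (subst (_≤ t) tent-at-centre (tent-bound (suc t) t far-last near-row w))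
    where
    far-last : suc t ≤ ∣ m - t ∣
    far-last = subst (suc t ≤_) (sym (m≤n⇒∣n-m∣≡n∸m (s≤s⁻¹ t<1+m))) (m+n≤o⇒m≤o∸n (suc t) 2t<m)
    near-row : ∀ i → r i ≡ true → suc t ≤ suc ∣ toℕ i - t ∣
    near-row i ri with does-true⇒ (row? i) ri
    ... | inj₁ i≡0  = s≤s (subst (λ p → t ≤ ∣ p - t ∣) (sym i≡0) ≤-refl)
    ... | inj₂ 2t≤i = s≤s (≤-trans (m+n≤o⇒m≤o∸n t 2t≤i) (m∸n≤∣m-n∣ (toℕ i) t))
    tent-at-centre : suc t ∸ ∣ toℕ centre - t ∣ ≡ suc t
    tent-at-centre = cong (suc t ∸_) (trans (cong ∣_- t ∣ (toℕ-fromℕ< t<1+m)) (∣n-n∣≡0 t))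

exponent-complete-α1 : ∀ {m k} → 1 ≤ m → (∃ λ t → t ≤ (m ∸ 1) / 2 × k ≡ 2 * (t + 1)) →
                       InE (suc m) true true k
exponent-complete-α1 {m} 1≤m (t , t≤h , refl) =
  r , last-row⁻¹ (row⇒r (inj₁ refl)) loop , isExponent⇒primitive exp ,
  subst (IsExponent M) (cong (2 *_) (+-comm 1 t)) exp
  where
  open GapRow {t = t} (t≤[m∸1]/2⇒2t<m 1≤m t≤h)
  exp : IsExponent M (2 * suc t)
  exp = isExponent-2[1+D] loop t radius centre far

-- Last row 0 ⋯ 0 1 ⋯ 1 with ones from D: vertex 0 is then at distance D + 1 from the
-- last vertex, and every vertex within D + 1.
module TailRow {m D : ℕ} (D<m : D < m) where

  r : Fin (suc m) → Bool
  r j = does (D ≤? toℕ j)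

  open CompanionGraph m r public

  loop : r last ≡ true
  loop = dec-true (D ≤? toℕ last) (subst (D ≤_) (sym (toℕ-fromℕ m)) (<⇒≤ D<m))

  radius : Radius (suc D)
  radius i with D ≤? toℕ i
  ... | yes D≤i = pad loop (i , edge-last (dec-true (D ≤? toℕ i) D≤i) , refl) (s≤s z≤n)
  ... | no  D≰i = pad loop (walk-via q (dec-true (D ≤? toℕ q) (≤-reflexive (sym q≡D))) i) (s≤s dist)
    where
    q : Fin (suc m)
    q = fromℕ< (s≤s (<⇒≤ D<m))
    q≡D : toℕ q ≡ D
    q≡D = toℕ-fromℕ< (s≤s (<⇒≤ D<m))
    dist : ∣ toℕ q - toℕ i ∣ ≤ D
    dist = subst (λ p → ∣ p - toℕ i ∣ ≤ D) (sym q≡D)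
             (subst (_≤ D) (sym (m≤n⇒∣n-m∣≡n∸m (<⇒≤ (≰⇒> D≰i)))) (m∸n≤m D (toℕ i)))

  far : ¬ Walk D last fzero
  far w = 1+n≰n (tent-bound (suc D) 0 (subst (suc D ≤_) (sym (∣-∣-identityʳ m)) D<m) near-row w)
    where
    near-row : ∀ i → r i ≡ true → suc D ≤ suc ∣ toℕ i - 0 ∣
    near-row i ri = s≤s (subst (D ≤_) (sym (∣-∣-identityʳ (toℕ i))) (does-true⇒ (D ≤? toℕ i) ri))

exponent-complete-α0 : ∀ {m k} → (∃ λ t → 2 ≤ t × t ≤ m × k ≡ 2 * t) → InE (suc m) false true k
exponent-complete-α0 {m} (suc D , s≤s 1≤D , D<m , refl) =
  r , last-row⁻¹ (dec-false (D ≤? 0) (<⇒≱ 1≤D)) loop , isExponent⇒primitive exp , exp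
  where
  open TailRow D<m
  exp : IsExponent M (2 * suc D)
  exp = isExponent-2[1+D] loop D radius fzero far

corollary3 : (n : ℕ) → 4 ≤ n →
    ((k : ℕ) → InE n true true k ⇔ Σ ℕ (λ t → t ≤ (n ∸ 2) / 2 × k ≡ 2 * (t + 1)))
    × ((k : ℕ) → InE n false true k ⇔ Σ ℕ (λ t → 2 ≤ t × t ≤ n ∸ 1 × k ≡ 2 * t))
corollary3 zero ()
corollary3 (suc m) 4≤n =
  (λ k → mk⇔ (exponent-sound-α1 1≤m) (exponent-complete-α1 1≤m)) ,
  (λ k → mk⇔ (exponent-sound-α0 2≤m) exponent-complete-α0)
  where
  2≤m : 2 ≤ m
  2≤m = ≤-trans (n≤1+n 2) (s≤s⁻¹ 4≤n)
  1≤m : 1 ≤ m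
  1≤m = ≤-trans (n≤1+n 1) 2≤m
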